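{- Let $G$ and $H$ be finite simple graphs with at least $3$ vertices, let $\{G_i\}_{i\in I}$ and $\{H_i\}_{i\in I}$ be their single-vertex-deleted subgraphs, indexed by a common index set $I$, and suppose there are isomorphisms $\gamma_i:G_i\to H_i$ for all $i\in I$. Work in the category $\mathbf{StGrphs}$. Let $\kappa_i:H_i\to H$ be the inclusions and let $\Gamma:\coprod_{i\in I}G_i\to H$ be the morphism induced by the maps $\kappa_i\gamma_i$ via the universal property of the coproduct. Let $p_0,p_1:\coprod_{i\in I}G_i\times\coprod_{i\in I}G_i\to\coprod_{i\in I}G_i$ be the product projections and let $k:R_\Gamma\to \coprod_{i\in I}G_i\times\coprod_{i\in I}G_i$ be the equalizer of $\Gamma p_0$ and $\Gamma p_1$. Then $G$ is vertex-reconstructable if and only if there exists an epimorphism $\delta:\coprod_{i\in I}G_i\to G$ in $\mathbf{StGrphs}$ such that $\delta p_0k=\delta p_1k$.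
   Context: Here "$G$ is vertex-reconstructable" means, in this setting, that $G$ is isomorphic to $H$. A graph $X$ has vertex set $V(X)$, edge set $E(X)$ and incidence function $\psi_X$ assigning each edge an unordered pair of (not necessarily distinct) vertices; the part set is $P(X)=E(X)\cup V(X)$, and $\psi_X(v)=\{v,v\}$ for vertices. A strict graph morphism $f:X\to Y$ is a function $P(X)\to P(Y)$ mapping vertices to vertices and edges to edges with $\psi_Y(f(e))=\{f(x),f(y)\}$ whenever $\psi_X(e)=\{x,y\}$. $\mathbf{StGrphs}$ is the category of all graphs (multiple edges and loops allowed) with strict graph morphisms. The coproduct is disjoint union. The product $X\times Y$ has vertex set $V(X)\times V(Y)$ and, for edges $e\in E(X)$ with $\psi_X(e)=\{a_1,a_2\}$ and $f\in E(Y)$ with $\psi_Y(f)=\{b_1,b_2\}$, an edge $(e,f)$ with ends $(a_1,b_1),(a_2,b_2)$ and, if $a_1\ne a_2$ and $b_1\ne b_2$, a further edge $\overline{(e,f)}$ with ends $(a_1,b_2),(a_2,b_1)$; the projections send $(u,v)$, $(e,f)$, $\overline{(e,f)}$ to their first (resp. second) coordinate. The equalizer of $f,g:X\to Y$ is the inclusion of the subgraph of $X$ consisting of those parts $a$ with $f(a)=g(a)$ and $f(a_j)=g(a_j)$ for the ends $a_1,a_2$ of $a$. -}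

module Defs where

open import Level using (Level)
open import Data.Nat using (ℕ; _≤_)
open import Data.Fin using (Fin)
open import Data.Unit using (⊤; tt)
open import Data.Product using (Σ; _×_; _,_; proj₁; proj₂)
open import Data.Sum using (_⊎_; inj₁; inj₂)
open import Data.Irrelevant as Irr using (Irrelevant; [_])
open import Data.Refinement using (Refinement; _,_; value; proof)
open import Relation.Binary.PropositionalEquality using (_≡_; _≢_; refl; sym; trans; cong)
open import Function.Bundles using (_↔_)

-- Graphs in StGrphs (multiple edges and loops allowed).
-- The incidence ψ(e) = {a₁,a₂} is represented by an ordered pair
-- 'ends e = (a₁ , a₂)', read as the unordered pair {a₁,a₂}.

record Graph : Set₁ where
  field
    V : Set
    E : Set
    ends : E → V × V
open Graph public

UEq : {A : Set} → A × A → A × A → Set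
UEq (a , b) (c , d) = (a ≡ c × b ≡ d) ⊎ (a ≡ d × b ≡ c)

map² : {A B : Set} → (A → B) → A × A → B × B
map² f (a , b) = f a , f b

UEq-map : {A B : Set} (f : A → B) {p q : A × A} → UEq p q → UEq (map² f p) (map² f q)
UEq-map f (inj₁ (refl , refl)) = inj₁ (refl , refl)
UEq-map f (inj₂ (refl , refl)) = inj₂ (refl , refl)

UEq-trans : {A : Set} {p q r : A × A} → UEq p q → UEq q r → UEq p r
UEq-trans (inj₁ (refl , refl)) y = y
UEq-trans (inj₂ (refl , refl)) (inj₁ (refl , refl)) = inj₂ (refl , refl)
UEq-trans (inj₂ (refl , refl)) (inj₂ (refl , refl)) = inj₁ (refl , refl)

record Hom (X Y : Graph) : Set where
  field
    fV : V X → V Y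
    fE : E X → E Y
    pres : ∀ e → UEq (ends Y (fE e)) (map² fV (ends X e))
open Hom public

idH : (X : Graph) → Hom X X
idH X = record { fV = λ v → v ; fE = λ e → e ; pres = λ e → inj₁ (refl , refl) }

infixr 9 _∘H_
_∘H_ : {X Y Z : Graph} → Hom Y Z → Hom X Y → Hom X Z
_∘H_ {X} {Y} {Z} g f = record
  { fV = λ v → fV g (fV f v)
  ; fE = λ e → fE g (fE f e)
  ; pres = λ e → UEq-trans (pres g (fE f e)) (UEq-map (fV g) (pres f e))
  }

infix 4 _≈H_
_≈H_ : {X Y : Graph} → Hom X Y → Hom X Y → Set
_≈H_ {X} f g = (∀ v → fV f v ≡ fV g v) × (∀ e → fE f e ≡ fE g e)

IsEpi : {X Y : Graph} → Hom X Y → Set₁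
IsEpi {X} {Y} δ = (Z : Graph) (g h : Hom Y Z) → g ∘H δ ≈H h ∘H δ → g ≈H h

record Iso (X Y : Graph) : Set where
  field
    to   : Hom X Y
    from : Hom Y X
    from∘to : from ∘H to ≈H idH X
    to∘from : to ∘H from ≈H idH Y
open Iso public

Loopless : Graph → Set
Loopless X = ∀ e → proj₁ (ends X e) ≢ proj₂ (ends X e)

NoMultiEdges : Graph → Set
NoMultiEdges X = ∀ e e' → UEq (ends X e) (ends X e') → e ≡ e'

IsFiniteSimple : Graph → Set
IsFiniteSimple X = Σ ℕ (λ n → V X ↔ Fin n) × Loopless X × NoMultiEdges X

AtLeast3Vertices : Graph → Set
AtLeast3Vertices X = Σ ℕ (λ n → (V X ↔ Fin n) × 3 ≤ n)

_─_ : (X : Graph) → V X → Graph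
X ─ v = record
  { V = Refinement (V X) (λ u → u ≢ v)
  ; E = Refinement (E X) (λ e → proj₁ (ends X e) ≢ v × proj₂ (ends X e) ≢ v)
  ; ends = λ { (e , p) → (proj₁ (ends X e) , Irr.map proj₁ p)
                       , (proj₂ (ends X e) , Irr.map proj₂ p) }
  }

incl : (X : Graph) (v : V X) → Hom (X ─ v) X
incl X v = record { fV = value ; fE = value ; pres = λ e → inj₁ (refl , refl) }

∐ : {I : Set} → (I → Graph) → Graph
∐ {I} X = record
  { V = Σ I (λ i → V (X i))
  ; E = Σ I (λ i → E (X i))
  ; ends = λ { (i , e) → (i , proj₁ (ends (X i) e)) , (i , proj₂ (ends (X i) e)) }
  }

copair : {I : Set} {X : I → Graph} {Z : Graph} → ((i : I) → Hom (X i) Z) → Hom (∐ X) Z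
copair h = record
  { fV = λ { (i , v) → fV (h i) v }
  ; fE = λ { (i , e) → fE (h i) e }
  ; pres = λ { (i , e) → pres (h i) e }
  }

data PKind (X Y : Graph) (e : E X) (f : E Y) : Set where
  plain : PKind X Y e f
  bar   : Irrelevant (proj₁ (ends X e) ≢ proj₂ (ends X e)) →
          Irrelevant (proj₁ (ends Y f) ≢ proj₂ (ends Y f)) → PKind X Y e f

prodEnds : (X Y : Graph) (e : E X) (f : E Y) → PKind X Y e f → (V X × V Y) × (V X × V Y)
prodEnds X Y e f plain = (proj₁ (ends X e) , proj₁ (ends Y f)) , (proj₂ (ends X e) , proj₂ (ends Y f))
prodEnds X Y e f (bar _ _) = (proj₁ (ends X e) , proj₂ (ends Y f)) , (proj₂ (ends X e) , proj₁ (ends Y f))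

_⊗_ : Graph → Graph → Graph
X ⊗ Y = record
  { V = V X × V Y
  ; E = Σ (E X × E Y) (λ { (e , f) → PKind X Y e f })
  ; ends = λ { ((e , f) , k) → prodEnds X Y e f k }
  }

π₀ : (X Y : Graph) → Hom (X ⊗ Y) X
π₀ X Y = record
  { fV = proj₁
  ; fE = λ { ((e , f) , k) → e }
  ; pres = λ { ((e , f) , plain) → inj₁ (refl , refl)
             ; ((e , f) , bar _ _) → inj₁ (refl , refl) }
  }

π₁ : (X Y : Graph) → Hom (X ⊗ Y) Y
π₁ X Y = record
  { fV = proj₂
  ; fE = λ { ((e , f) , k) → f }
  ; pres = λ { ((e , f) , plain) → inj₁ (refl , refl)
             ; ((e , f) , bar _ _) → inj₂ (refl , refl) }
  }

EqCond : {X Y : Graph} (f g : Hom X Y) → E X → Set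
EqCond {X} f g e = fE f e ≡ fE g e
                 × fV f (proj₁ (ends X e)) ≡ fV g (proj₁ (ends X e))
                 × fV f (proj₂ (ends X e)) ≡ fV g (proj₂ (ends X e))

Equalizer : {X Y : Graph} (f g : Hom X Y) → Graph
Equalizer {X} f g = record
  { V = Refinement (V X) (λ v → fV f v ≡ fV g v)
  ; E = Refinement (E X) (EqCond f g)
  ; ends = λ { (e , p) → (proj₁ (ends X e) , Irr.map (λ q → proj₁ (proj₂ q)) p)
                       , (proj₂ (ends X e) , Irr.map (λ q → proj₂ (proj₂ q)) p) }
  }

eqIncl : {X Y : Graph} (f g : Hom X Y) → Hom (Equalizer f g) X
eqIncl f g = record { fV = value ; fE = value ; pres = λ e → inj₁ (refl , refl) }

Γmap : (G H : Graph) {I : Set} (σ : I → V G) (τ : I → V H)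
       (γ : (i : I) → Iso (G ─ σ i) (H ─ τ i)) → Hom (∐ (λ i → G ─ σ i)) H
Γmap G H σ τ γ = copair (λ i → incl H (τ i) ∘H to (γ i))

-- If φ : G ≅ H, take δ = φ⁻¹ ∘ Γ. Since H has at least three vertices, every vertex and every
-- edge of H avoids some deleted vertex τ i, so Γ is onto on vertices and edges; hence δ is an
-- epimorphism, and δ coequalises the kernel pair of Γ because Γ does.
-- Conversely, such a δ factors as δ = u ∘ Γ with u : H → G, and u is onto on vertices because
-- δ is epi, hence bijective on vertices (both graphs have |I| vertices). It remains to see that
-- u⁻¹ preserves adjacency, which is Kelly's counting argument: for a loopless graph X on n ≥ 3
-- vertices, Σᵢ |E(X - i)| = (n - 2) |E(X)|. The γ i match the edges of G - σ i with those of
-- H - τ i, so G and H have equally many edges, and u maps the edges of H injectively into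
-- those of G; so every edge of G comes from an edge of H.

module Submission where

open import Defs
open import Data.Bool.Base using (Bool; true; false; T; not; _∧_; _∨_; if_then_else_)
open import Data.Bool.Properties using (T?; T-≡)
open import Data.Empty using (⊥-elim; ⊥-elim-irr)
open import Data.Fin.Base using (Fin; zero; suc; punchOut)
open import Data.Fin.Patterns using (0F; 1F; 2F)
open import Data.Fin.Permutation using (Permutation′; permutation; _⟨$⟩ʳ_; _⟨$⟩ˡ_; inverseˡ; inverseʳ; flip)
open import Data.Fin.Properties using (_≟_; any?; punchOut-injective; injective⇒≤)
open import Data.Irrelevant using ([_])
open import Data.Nat.Base using (ℕ; zero; suc; _+_; _*_; _≤_; _<_; z≤n; s≤s)
open import Data.Nat.Properties using (+-*-semiring; ≤-refl; ≤-trans; ≤-reflexive; ≤-antisym; <⇒≱; n≮n; m≤n+m; +-comm; +-suc; +-identityʳ; *-identityʳ; *-zeroʳ; *-distribʳ-+; +-cancelʳ-≡; *-cancelˡ-≡; +-mono-≤; +-monoˡ-≤; +-monoˡ-<; +-monoʳ-<; +-mono-<-≤; +-mono-≤-<)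
open import Algebra.Properties.Semiring.Sum +-*-semiring using (sum; sum-syntax; sum-cong-≗; ∑-distrib-+; ∑-comm; ∑-permute; *-distribˡ-sum; sum-replicate-zero)
open import Data.Product using (Σ; _×_; _,_; ∃; ∃₂; proj₁; proj₂)
open import Data.Refinement using (_,_; value)
open import Data.Sum as Sum using (_⊎_; inj₁; inj₂)
open import Function.Base using (_on_; _∘_)
open import Function.Bundles using (_↔_; _⇔_; Inverse; Injection; Equivalence; mk⇔; mk↔ₛ′)
open import Function.Definitions using (Injective; StrictlySurjective)
open import Function.Properties.Inverse using (↔-trans; ↔-sym; ↔⇒↣)
open import Relation.Binary.Core using (_⇒_)
open import Relation.Binary.Definitions using (DecidableEquality; Irreflexive)
open import Relation.Binary.PropositionalEquality
open import Relation.Nullary using (¬_; Dec; yes; no; does; isYes; contradiction)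
open import Relation.Nullary.Decidable using (map′; recompute; via-injection; toWitness; fromWitness; _×-dec_; _⊎-dec_)
open import Relation.Unary using (Decidable)

open Inverse using (strictlyInverseˡ; strictlyInverseʳ)

𝟙 : Bool → ℕ
𝟙 b = if b then 1 else 0

∑-mono-≤ : ∀ {n} {f g : Fin n → ℕ} → (∀ i → f i ≤ g i) → sum f ≤ sum g
∑-mono-≤ {zero}  f≤g = z≤n
∑-mono-≤ {suc n} f≤g = +-mono-≤ (f≤g zero) (∑-mono-≤ (λ i → f≤g (suc i)))

∑-mono-< : ∀ {n} {f g : Fin n → ℕ} → (∀ i → f i ≤ g i) → ∀ j → f j < g j → sum f < sum g
∑-mono-< {suc n} f≤g zero    f<g = +-mono-<-≤ f<g (∑-mono-≤ (λ i → f≤g (suc i)))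
∑-mono-< {suc n} f≤g (suc j) f<g = +-mono-≤-< (f≤g zero) (∑-mono-< (λ i → f≤g (suc i)) j f<g)

∑-bounded : ∀ {n c} {f : Fin n → ℕ} → (∀ i → f i ≤ c) → sum f ≤ n * c
∑-bounded {zero}  f≤c = z≤n
∑-bounded {suc n} f≤c = +-mono-≤ (f≤c zero) (∑-bounded (λ i → f≤c (suc i)))

𝟙-mono : ∀ {a b} → (T a → T b) → 𝟙 a ≤ 𝟙 b
𝟙-mono {false}         _   = z≤n
𝟙-mono {true}  {true}  _   = ≤-refl
𝟙-mono {true}  {false} a⇒b = ⊥-elim (a⇒b _)

𝟙-mono-< : ∀ {a b} → ¬ T a → T b → 𝟙 a < 𝟙 b
𝟙-mono-< {false} {true} _ _ = ≤-refl
𝟙-mono-< {true}         ¬a _ = ⊥-elim (¬a _)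

𝟙≤1 : ∀ b → 𝟙 b ≤ 1
𝟙≤1 true  = ≤-refl
𝟙≤1 false = z≤n

∑-ones : ∀ n → ∑[ _ < n ] 1 ≡ n
∑-ones zero    = refl
∑-ones (suc n) = cong suc (∑-ones n)

∑-point : ∀ {n} (x : Fin n) → ∑[ i < n ] 𝟙 (does (x ≟ i)) ≡ 1
∑-point {suc n} zero    = cong suc (sum-replicate-zero n)
∑-point {suc n} (suc x) = ∑-point x

∑²-distrib-+ : ∀ {n} (F G : Fin n → Fin n → ℕ) →
               ∑[ x < n ] ∑[ y < n ] (F x y + G x y) ≡ (∑[ x < n ] ∑[ y < n ] F x y) + (∑[ x < n ] ∑[ y < n ] G x y)
∑²-distrib-+ F G =
  trans (sum-cong-≗ λ x → ∑-distrib-+ (F x) (G x)) (∑-distrib-+ (λ x → ∑[ y < _ ] F x y) (λ x → ∑[ y < _ ] G x y))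

*-distribˡ-∑² : ∀ {n} c (F : Fin n → Fin n → ℕ) →
                c * (∑[ x < n ] ∑[ y < n ] F x y) ≡ ∑[ x < n ] ∑[ y < n ] (c * F x y)
*-distribˡ-∑² c F = trans (*-distribˡ-sum c (λ x → ∑[ y < _ ] F x y)) (sum-cong-≗ λ x → *-distribˡ-sum c (F x))

all-or-witness : ∀ {n} {P Q : Fin n → Set} → (∀ i → P i ⊎ Q i) → (∀ i → P i) ⊎ ∃ Q
all-or-witness {zero}  _   = inj₁ λ ()
all-or-witness {suc n} dec with dec zero | all-or-witness (λ i → dec (suc i))
... | inj₂ q | _            = inj₂ (zero , q)
... | inj₁ _ | inj₂ (i , q) = inj₂ (suc i , q)
... | inj₁ p | inj₁ ps      = inj₁ λ { zero → p ; (suc i) → ps i }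

-- Counting Boolean relations on Fin n

BRel : ℕ → Set
BRel n = Fin n → Fin n → Bool

⟦_⟧ : ∀ {n} → BRel n → Fin n → Fin n → Set
⟦ S ⟧ x y = T (S x y)

module _ {n : ℕ} where

  count : BRel n → ℕ
  count S = ∑[ x < n ] ∑[ y < n ] 𝟙 (S x y)

  count-mono : ∀ {S S' : BRel n} → ⟦ S ⟧ ⇒ ⟦ S' ⟧ → count S ≤ count S'
  count-mono {S} {S'} S⊆S' = ∑-mono-≤ λ x → ∑-mono-≤ λ y → 𝟙-mono {S x y} {S' x y} S⊆S'

  count-mono-< : ∀ {S S' : BRel n} → ⟦ S ⟧ ⇒ ⟦ S' ⟧ → ∀ {a b} → ¬ ⟦ S ⟧ a b → ⟦ S' ⟧ a b → count S < count S'
  count-mono-< {S} {S'} S⊆S' {a} {b} ∉S ∈S' =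
    ∑-mono-< (λ x → ∑-mono-≤ λ y → 𝟙-mono {S x y} {S' x y} S⊆S') a
      (∑-mono-< (λ y → 𝟙-mono {S a y} {S' a y} S⊆S') b (𝟙-mono-< {S a b} ∉S ∈S'))

  count≤n² : ∀ (S : BRel n) → count S ≤ n * n
  count≤n² S = ∑-bounded λ x → ≤-trans (∑-bounded λ y → 𝟙≤1 (S x y)) (≤-reflexive (*-identityʳ n))

  count-permute : ∀ (S : BRel n) (π : Permutation′ n) → count (S on (π ⟨$⟩ʳ_)) ≡ count S
  count-permute S π = begin
    ∑[ x < n ] ∑[ y < n ] 𝟙 (S (π ⟨$⟩ʳ x) (π ⟨$⟩ʳ y)) ≡⟨ sum-cong-≗ (λ x → ∑-permute (λ y → 𝟙 (S (π ⟨$⟩ʳ x) y)) π) ⟨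
    ∑[ x < n ] ∑[ y < n ] 𝟙 (S (π ⟨$⟩ʳ x) y)           ≡⟨ ∑-permute (λ x → ∑[ y < n ] 𝟙 (S x y)) π ⟨
    count S                                            ∎
    where open ≡-Reasoning

  ⊇-by-count : ∀ {S S' : BRel n} → ⟦ S ⟧ ⇒ ⟦ S' ⟧ → count S' ≤ count S → ⟦ S' ⟧ ⇒ ⟦ S ⟧
  ⊇-by-count {S} S⊆S' S'≤S {a} {b} ∈S' with T? (S a b)
  ... | yes ∈S = ∈S
  ... | no  ∉S = contradiction S'≤S (<⇒≱ (count-mono-< S⊆S' ∉S ∈S'))

  count-map : ∀ {S S' : BRel n} (π : Permutation′ n) → ⟦ S ⟧ ⇒ (⟦ S' ⟧ on (π ⟨$⟩ʳ_)) → count S ≤ count S'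
  count-map {S' = S'} π S↦S' = ≤-trans (count-mono S↦S') (≤-reflexive (count-permute S' π))

  map-inverse-by-count : ∀ {S S' : BRel n} (π : Permutation′ n) → ⟦ S ⟧ ⇒ (⟦ S' ⟧ on (π ⟨$⟩ʳ_)) →
                         count S' ≤ count S → ⟦ S' ⟧ ⇒ (⟦ S ⟧ on (π ⟨$⟩ˡ_))
  map-inverse-by-count {S} {S'} π S↦S' S'≤S =
    ⊇-by-count pulled-back⊆S' (≤-trans S'≤S (≤-reflexive (sym (count-permute S (flip π)))))
    where
    pulled-back⊆S' : ⟦ S on (π ⟨$⟩ˡ_) ⟧ ⇒ ⟦ S' ⟧
    pulled-back⊆S' ∈S = subst₂ ⟦ S' ⟧ (inverseʳ π) (inverseʳ π) (S↦S' ∈S)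

  _≐_ : Fin n → Fin n → Bool
  x ≐ y = does (x ≟ y)

  _∖_ : BRel n → Fin n → BRel n
  (S ∖ i) x y = S x y ∧ not (x ≐ i) ∧ not (y ≐ i)

  ∑-avoiding : ∀ {x y} → x ≢ y → (∑[ i < n ] 𝟙 (not (x ≐ i) ∧ not (y ≐ i))) + 2 ≡ n
  ∑-avoiding {x} {y} x≢y = begin
    ∑[ i < n ] avoid i + 2                                  ≡⟨ cong (∑[ i < n ] avoid i +_) (cong₂ _+_ (∑-point x) (∑-point y)) ⟨
    ∑[ i < n ] avoid i + (∑[ i < n ] at x i + ∑[ i < n ] at y i) ≡⟨ cong (∑[ i < n ] avoid i +_) (∑-distrib-+ (at x) (at y)) ⟨
    ∑[ i < n ] avoid i + ∑[ i < n ] (at x i + at y i)        ≡⟨ ∑-distrib-+ avoid (λ i → at x i + at y i) ⟨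
    ∑[ i < n ] (avoid i + (at x i + at y i))                 ≡⟨ sum-cong-≗ partition ⟩
    ∑[ _ < n ] 1                                             ≡⟨ ∑-ones n ⟩
    n                                                        ∎
    where
    open ≡-Reasoning
    avoid : Fin n → ℕ
    avoid i = 𝟙 (not (x ≐ i) ∧ not (y ≐ i))
    at : Fin n → Fin n → ℕ
    at z i = 𝟙 (z ≐ i)
    partition : ∀ i → avoid i + (at x i + at y i) ≡ 1
    partition i with x ≟ i | y ≟ i
    ... | yes refl | yes refl = contradiction refl x≢y
    ... | yes _    | no _     = refl
    ... | no _     | yes _    = refl
    ... | no _     | no _     = refl

  deletions-of-pair : ∀ (S : BRel n) {x y} → (⟦ S ⟧ x y → x ≢ y) →
                      (∑[ i < n ] 𝟙 ((S ∖ i) x y)) + 2 * 𝟙 (S x y) ≡ n * 𝟙 (S x y)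
  deletions-of-pair S {x} {y} irr with S x y
  ... | false = trans (+-identityʳ _) (trans (sum-replicate-zero n) (sym (*-zeroʳ n)))
  ... | true  = trans (∑-avoiding (irr _)) (sym (*-identityʳ n))

  kelly-identity : ∀ (S : BRel n) → Irreflexive _≡_ ⟦ S ⟧ →
                   (∑[ i < n ] count (S ∖ i)) + 2 * count S ≡ n * count S
  kelly-identity S irr = begin
    (∑[ i < n ] ∑[ x < n ] ∑[ y < n ] 𝟙 ((S ∖ i) x y)) + 2 * count S
      ≡⟨ cong₂ _+_ (trans (∑-comm (λ i x → ∑[ y < n ] 𝟙 ((S ∖ i) x y))) (sum-cong-≗ λ x → ∑-comm (λ i y → 𝟙 ((S ∖ i) x y))))
                   (*-distribˡ-∑² 2 (λ x y → 𝟙 (S x y))) ⟩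
    (∑[ x < n ] ∑[ y < n ] ∑[ i < n ] 𝟙 ((S ∖ i) x y)) + (∑[ x < n ] ∑[ y < n ] (2 * 𝟙 (S x y)))
      ≡⟨ ∑²-distrib-+ (λ x y → ∑[ i < n ] 𝟙 ((S ∖ i) x y)) (λ x y → 2 * 𝟙 (S x y)) ⟨
    ∑[ x < n ] ∑[ y < n ] ((∑[ i < n ] 𝟙 ((S ∖ i) x y)) + 2 * 𝟙 (S x y))
      ≡⟨ sum-cong-≗ (λ x → sum-cong-≗ λ y → deletions-of-pair S {x} {y} (λ ∈S x≡y → irr x≡y ∈S)) ⟩
    ∑[ x < n ] ∑[ y < n ] (n * 𝟙 (S x y))
      ≡⟨ *-distribˡ-∑² n (λ x y → 𝟙 (S x y)) ⟨
    n * count S ∎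
    where open ≡-Reasoning

  ∖-sound : ∀ {S : BRel n} {i x y} → ⟦ S ∖ i ⟧ x y → ⟦ S ⟧ x y × x ≢ i × y ≢ i
  ∖-sound {S} {i} {x} {y} ∈S∖i with S x y | x ≟ i | y ≟ i
  ... | true | no x≢i | no y≢i = _ , x≢i , y≢i

  ∖-complete : ∀ {S : BRel n} {i x y} → ⟦ S ⟧ x y → x ≢ i → y ≢ i → ⟦ S ∖ i ⟧ x y
  ∖-complete {S} {i} {x} {y} ∈S x≢i y≢i with S x y | x ≟ i | y ≟ i
  ... | true | no _     | no _     = _
  ... | _    | yes x≡i  | _        = contradiction x≡i x≢i
  ... | _    | no _     | yes y≡i  = contradiction y≡i y≢i

  ∖-map : ∀ {S S' : BRel n} (π : Permutation′ n) {i} → π ⟨$⟩ʳ i ≡ i →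
          ⟦ S ∖ i ⟧ ⇒ (⟦ S' ⟧ on (π ⟨$⟩ʳ_)) → ⟦ S ∖ i ⟧ ⇒ (⟦ S' ∖ i ⟧ on (π ⟨$⟩ʳ_))
  ∖-map {S} {S'} π {i} πi≡i S∖i↦S' ∈S∖i =
    let _ , x≢i , y≢i = ∖-sound {S} ∈S∖i in
    ∖-complete {S'} (S∖i↦S' ∈S∖i) (moves x≢i) (moves y≢i)
    where
    moves : ∀ {x} → x ≢ i → π ⟨$⟩ʳ x ≢ i
    moves {x} x≢i πx≡i = x≢i (begin
      x                      ≡⟨ inverseˡ π ⟨
      π ⟨$⟩ˡ (π ⟨$⟩ʳ x)      ≡⟨ cong (π ⟨$⟩ˡ_) (trans πx≡i (sym πi≡i)) ⟩
      π ⟨$⟩ˡ (π ⟨$⟩ʳ i)      ≡⟨ inverseˡ π ⟩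
      i                      ∎)
      where open ≡-Reasoning

  insert : BRel n → Fin n → Fin n → BRel n
  insert S a b x y = S x y ∨ (x ≐ a ∧ y ≐ b)

  ⊆-insert : ∀ {S : BRel n} {a b} → ⟦ S ⟧ ⇒ ⟦ insert S a b ⟧
  ⊆-insert {S} {x = x} {y} ∈S with S x y
  ... | true = _

  ∈-insert : ∀ (S : BRel n) a b → ⟦ insert S a b ⟧ a b
  ∈-insert S a b with S a b | a ≟ a | b ≟ b
  ... | true  | _       | _       = _
  ... | false | yes _   | yes _   = _
  ... | false | no a≢a  | _       = a≢a refl
  ... | false | yes _   | no b≢b  = b≢b refl

  insert-⊆ : ∀ {S : BRel n} {R : Fin n → Fin n → Set} {a b} → ⟦ S ⟧ ⇒ R → R a b → ⟦ insert S a b ⟧ ⇒ R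
  insert-⊆ {S} {a = a} {b} S⊆R Rab {x} {y} ∈ins with S x y in eq | x ≟ a | y ≟ b
  ... | true  | _        | _        = S⊆R (subst T (sym eq) _)
  ... | false | yes refl | yes refl = Rab

  count-insert : ∀ {S : BRel n} {a b} → ¬ ⟦ S ⟧ a b → count S < count (insert S a b)
  count-insert {S} {a} {b} ∉S = count-mono-< {S} {insert S a b} (⊆-insert {S}) ∉S (∈-insert S a b)

  maps? : ∀ (S S' : BRel n) (f : Fin n → Fin n) →
          (⟦ S ⟧ ⇒ (⟦ S' ⟧ on f)) ⊎ ∃₂ λ x y → ⟦ S ⟧ x y × ¬ ⟦ S' ⟧ (f x) (f y)
  maps? S S' f = Sum.map₁ (λ maps {x} {y} → maps x y) (all-or-witness λ x → all-or-witness λ y → maps-at x y)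
    where
    maps-at : ∀ x y → (⟦ S ⟧ x y → ⟦ S' ⟧ (f x) (f y)) ⊎ (⟦ S ⟧ x y × ¬ ⟦ S' ⟧ (f x) (f y))
    maps-at x y with T? (S' (f x) (f y)) | T? (S x y)
    ... | yes ∈S' | _      = inj₁ λ _ → ∈S'
    ... | no ∉S'  | yes ∈S = inj₂ (∈S , ∉S')
    ... | no _    | no ∉S  = inj₁ λ ∈S → contradiction ∈S ∉S

count-determined-by-deletions : ∀ {n} → 3 ≤ n → ∀ {S S' : BRel n} → Irreflexive _≡_ ⟦ S ⟧ → Irreflexive _≡_ ⟦ S' ⟧ →
                                (∀ i → count (S ∖ i) ≡ count (S' ∖ i)) → count S ≡ count S'
count-determined-by-deletions {suc (suc (suc m))} (s≤s (s≤s (s≤s _))) {S} {S'} irr irr' same =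
  *-cancelˡ-≡ (count S) (count S') (suc m) (begin
    suc m * count S             ≡⟨ deletions-sum (kelly-identity S irr) ⟨
    ∑[ i < _ ] count (S ∖ i)    ≡⟨ sum-cong-≗ same ⟩
    ∑[ i < _ ] count (S' ∖ i)   ≡⟨ deletions-sum (kelly-identity S' irr') ⟩
    suc m * count S'            ∎)
  where
  open ≡-Reasoning
  deletions-sum : ∀ {K c} → K + 2 * c ≡ suc (suc (suc m)) * c → K ≡ suc m * c
  deletions-sum {K} {c} eq = +-cancelʳ-≡ (2 * c) K (suc m * c)
    (trans eq (trans (*-distribʳ-+ c 2 (suc m)) (+-comm (2 * c) (suc m * c))))

avoid-two : ∀ {n} → 3 ≤ n → (a b : Fin n) → ∃ λ c → c ≢ a × c ≢ b
avoid-two (s≤s (s≤s (s≤s _))) a b with 0F ≟ a | 0F ≟ b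
... | no 0≢a   | no 0≢b   = 0F , 0≢a , 0≢b
... | yes refl | _        with 1F ≟ b
...   | no 1≢b   = 1F , (λ ()) , 1≢b
...   | yes refl = 2F , (λ ()) , (λ ())
avoid-two (s≤s (s≤s (s≤s _))) a b | no 0≢a | yes refl with 1F ≟ a
...   | no 1≢a   = 1F , 1≢a , (λ ())
...   | yes refl = 2F , (λ ()) , (λ ())

injective⇒surjective : ∀ {n} (f : Fin n → Fin n) → Injective _≡_ _≡_ f → StrictlySurjective _≡_ f
injective⇒surjective {suc n} f f-inj y with any? (λ x → f x ≟ y)
... | yes hit  = hit
... | no  miss = contradiction (injective⇒≤ punched-injective) (n≮n n)
  where
  punched : Fin (suc n) → Fin n
  punched x = punchOut (λ y≡fx → miss (x , sym y≡fx))
  punched-injective : Injective _≡_ _≡_ punched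
  punched-injective {x} {x'} eq =
    f-inj (punchOut-injective {i = y} (λ y≡fx → miss (x , sym y≡fx)) (λ y≡fx → miss (x' , sym y≡fx)) eq)

surjection⇒permutation : ∀ {n} (f : Fin n → Fin n) → StrictlySurjective _≡_ f → Permutation′ n
surjection⇒permutation f surj = permutation f section (λ y → proj₂ (surj y)) retraction
  where
  section = λ y → proj₁ (surj y)
  section-injective : Injective _≡_ _≡_ section
  section-injective {y} {y'} eq = trans (sym (proj₂ (surj y))) (trans (cong f eq) (proj₂ (surj y')))
  retraction : ∀ x → section (f x) ≡ x
  retraction x with injective⇒surjective section section-injective x
  ... | y , refl = cong section (proj₂ (surj y))

-- Transferring adjacency along the deck

bounded-ascent : ∀ {State Result : Set} (size : State → ℕ) {bound : ℕ} → (∀ s → size s ≤ bound) →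
                 (∀ s → Result ⊎ Σ State (λ s' → size s < size s')) → State → Result
bounded-ascent {Result = Result} size {bound} size≤bound step s = climb (suc bound) s (m≤n+m (suc bound) (size s))
  where
  climb : ∀ fuel s → bound < size s + fuel → Result
  climb zero s bound<size = contradiction (size≤bound s) (<⇒≱ (subst (bound <_) (+-identityʳ (size s)) bound<size))
  climb (suc fuel) s bound<size with step s
  ... | inj₁ r              = r
  ... | inj₂ (s' , s<s')    = climb fuel s'
    (≤-trans bound<size (≤-trans (≤-reflexive (+-suc (size s) fuel)) (+-monoˡ-≤ fuel s<s')))

module Transfer {n : ℕ} (3≤n : 3 ≤ n)
  (g : Fin n → Permutation′ n) (g-fixes : ∀ i → g i ⟨$⟩ʳ i ≡ i) (u : Permutation′ n)
  (A B : Fin n → Fin n → Set) (A-irr : Irreflexive _≡_ A) (B-irr : Irreflexive _≡_ B)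
  (A⇒B : ∀ i {x y} → x ≢ i → y ≢ i → A x y → B (g i ⟨$⟩ʳ x) (g i ⟨$⟩ʳ y))
  (B⇒A : ∀ i {x y} → x ≢ i → y ≢ i → B x y → A (g i ⟨$⟩ˡ x) (g i ⟨$⟩ˡ y))
  (u-hom : B ⇒ (A on (u ⟨$⟩ʳ_)))
  where

  -- A and B need not be decidable, so the counting is done on a decidable approximation:
  -- sub-relations SA ⊆ A and SB ⊆ B, grown from a single pair of A until closed under the
  -- maps g i, their inverses and u.

  record Approximation : Set where
    field
      SA SB : BRel n
      SA⊆A : ⟦ SA ⟧ ⇒ A
      SB⊆B : ⟦ SB ⟧ ⇒ B
  open Approximation

  record IsClosed (P : Approximation) : Set where
    field
      SA↦SB   : ∀ i → ⟦ SA P ∖ i ⟧ ⇒ (⟦ SB P ⟧ on (g i ⟨$⟩ʳ_))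
      SB↦SA   : ∀ i → ⟦ SB P ∖ i ⟧ ⇒ (⟦ SA P ⟧ on (g i ⟨$⟩ˡ_))
      SB↦SA-u : ⟦ SB P ⟧ ⇒ (⟦ SA P ⟧ on (u ⟨$⟩ʳ_))

  g⁻¹-fixes : ∀ i → g i ⟨$⟩ˡ i ≡ i
  g⁻¹-fixes i = trans (cong (g i ⟨$⟩ˡ_) (sym (g-fixes i))) (inverseˡ (g i))

  closed⇒inverse-maps : ∀ {P} → IsClosed P → ⟦ SA P ⟧ ⇒ (⟦ SB P ⟧ on (u ⟨$⟩ˡ_))
  closed⇒inverse-maps {P} closed = map-inverse-by-count {S = SB P} {S' = SA P} u SB↦SA-u (≤-reflexive count-SA≡count-SB)
    where
    open IsClosed closed
    deletions-agree : ∀ i → count (SA P ∖ i) ≡ count (SB P ∖ i)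
    deletions-agree i = ≤-antisym
      (count-map {S = SA P ∖ i} {S' = SB P ∖ i} (g i) (∖-map {S = SA P} {S' = SB P} (g i) (g-fixes i) (SA↦SB i)))
      (count-map {S = SB P ∖ i} {S' = SA P ∖ i} (flip (g i)) (∖-map {S = SB P} {S' = SA P} (flip (g i)) (g⁻¹-fixes i) (SB↦SA i)))
    count-SA≡count-SB : count (SA P) ≡ count (SB P)
    count-SA≡count-SB = count-determined-by-deletions 3≤n
      (λ x≡y ∈SA → A-irr x≡y (SA⊆A P ∈SA)) (λ x≡y ∈SB → B-irr x≡y (SB⊆B P ∈SB)) deletions-agree

  size : Approximation → ℕ
  size P = count (SA P) + count (SB P)

  Growth : Approximation → Set
  Growth P = Σ Approximation λ Q → (⟦ SA P ⟧ ⇒ ⟦ SA Q ⟧) × size P < size Q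

  insertA : ∀ P {a b} → A a b → ¬ ⟦ SA P ⟧ a b → Growth P
  insertA P {a} {b} Aab ∉SA =
    record P { SA = insert (SA P) a b ; SA⊆A = insert-⊆ {S = SA P} (SA⊆A P) Aab } ,
    ⊆-insert {S = SA P} , +-monoˡ-< (count (SB P)) (count-insert {S = SA P} ∉SA)

  insertB : ∀ P {a b} → B a b → ¬ ⟦ SB P ⟧ a b → Growth P
  insertB P {a} {b} Bab ∉SB =
    record P { SB = insert (SB P) a b ; SB⊆B = insert-⊆ {S = SB P} (SB⊆B P) Bab } ,
    (λ ∈SA → ∈SA) , +-monoʳ-< (count (SA P)) (count-insert {S = SB P} ∉SB)

  close-or-grow : ∀ P → IsClosed P ⊎ Growth P
  close-or-grow P with all-or-witness (λ i → maps? (SA P ∖ i) (SB P) (g i ⟨$⟩ʳ_))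
  ... | inj₂ (i , x , y , ∈SA∖i , ∉SB) =
    let ∈SA , x≢i , y≢i = ∖-sound {S = SA P} ∈SA∖i in
    inj₂ (insertB P (A⇒B i x≢i y≢i (SA⊆A P ∈SA)) ∉SB)
  ... | inj₁ SA↦SB with all-or-witness (λ i → maps? (SB P ∖ i) (SA P) (g i ⟨$⟩ˡ_))
  ...   | inj₂ (i , x , y , ∈SB∖i , ∉SA) =
    let ∈SB , x≢i , y≢i = ∖-sound {S = SB P} ∈SB∖i in
    inj₂ (insertA P (B⇒A i x≢i y≢i (SB⊆B P ∈SB)) ∉SA)
  ...   | inj₁ SB↦SA with maps? (SB P) (SA P) (u ⟨$⟩ʳ_)
  ...     | inj₂ (x , y , ∈SB , ∉SA) = inj₂ (insertA P (u-hom (SB⊆B P ∈SB)) ∉SA)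
  ...     | inj₁ SB↦SA-u = inj₁ record { SA↦SB = SA↦SB ; SB↦SA = SB↦SA ; SB↦SA-u = SB↦SA-u }

  closure : ∀ {x y} → A x y → Σ Approximation λ P → IsClosed P × ⟦ SA P ⟧ x y
  closure {x} {y} Axy = bounded-ascent (λ (P , _) → size P) size-bounded step (seed , ∈-insert _ x y)
    where
    seed : Approximation
    seed = record { SA = insert (λ _ _ → false) x y ; SB = λ _ _ → false
                  ; SA⊆A = insert-⊆ {S = λ _ _ → false} {R = A} (λ ()) Axy ; SB⊆B = λ () }
    Seeded : Set
    Seeded = Σ Approximation λ P → ⟦ SA P ⟧ x y
    size-bounded : ∀ ((P , _) : Seeded) → size P ≤ n * n + n * n
    size-bounded (P , _) = +-mono-≤ (count≤n² (SA P)) (count≤n² (SB P))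
    step : ∀ ((P , _) : Seeded) →
           (Σ Approximation λ P → IsClosed P × ⟦ SA P ⟧ x y) ⊎ Σ Seeded λ (Q , _) → size P < size Q
    step (P , ∈P) with close-or-grow P
    ... | inj₁ closed             = inj₁ (P , closed , ∈P)
    ... | inj₂ (Q , P⊆Q , P<Q)    = inj₂ ((Q , P⊆Q ∈P) , P<Q)

  transfer : A ⇒ (B on (u ⟨$⟩ˡ_))
  transfer Axy with closure Axy
  ... | P , closed , ∈SA = SB⊆B P (closed⇒inverse-maps closed ∈SA)

private variable
  A : Set
  X Y Z : Graph

UEq-sym : {p q : A × A} → UEq p q → UEq q p
UEq-sym (inj₁ (refl , refl)) = inj₁ (refl , refl)
UEq-sym (inj₂ (refl , refl)) = inj₂ (refl , refl)

UEq-refl : (p : A × A) → UEq p p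
UEq-refl p = inj₁ (refl , refl)

UEq-dec : DecidableEquality A → (p q : A × A) → Dec (UEq p q)
UEq-dec _≟_ (a , b) (c , d) = ((a ≟ c) ×-dec (b ≟ d)) ⊎-dec ((a ≟ d) ×-dec (b ≟ c))

UEq-both : (P : A → Set) {p : A × A} {a b : A} → UEq p (a , b) → P a → P b → P (proj₁ p) × P (proj₂ p)
UEq-both P (inj₁ (refl , refl)) Pa Pb = Pa , Pb
UEq-both P (inj₂ (refl , refl)) Pa Pb = Pb , Pa

edge-decEq : DecidableEquality (V X) → NoMultiEdges X → DecidableEquality (E X)
edge-decEq {X} _≟_ simple e e' =
  map′ (simple e e') (λ { refl → UEq-refl (ends X e) }) (UEq-dec _≟_ (ends X e) (ends X e'))

Adjacent : (X : Graph) → V X → V X → Set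
Adjacent X a b = Σ (E X) λ e → UEq (ends X e) (a , b)

loopless⇒irreflexive : Loopless X → Irreflexive _≡_ (Adjacent X)
loopless⇒irreflexive {X} loopless refl (e , inj₁ (refl , ends≡)) = loopless e (sym ends≡)
loopless⇒irreflexive {X} loopless refl (e , inj₂ (refl , ends≡)) = loopless e (sym ends≡)

Hom-adjacent : (f : Hom X Y) → ∀ {a b} → Adjacent X a b → Adjacent Y (fV f a) (fV f b)
Hom-adjacent f (e , ends≡) = fE f e , UEq-trans (pres f e) (UEq-map (fV f) ends≡)

Hom-from-adjacency : (f : V X → V Y) → (∀ {a b} → Adjacent X a b → Adjacent Y (f a) (f b)) → Hom X Y
Hom-from-adjacency {X} f f-adj = record
  { fV = f
  ; fE = λ e → proj₁ (f-adj (e , UEq-refl (ends X e)))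
  ; pres = λ e → proj₂ (f-adj (e , UEq-refl (ends X e)))
  }

simple-iso : NoMultiEdges X → NoMultiEdges Y → (f : Hom X Y) (g : Hom Y X) →
             (∀ a → fV g (fV f a) ≡ a) → (∀ b → fV f (fV g b) ≡ b) → Iso X Y
simple-iso {X} {Y} simpleX simpleY f g g∘f≗id f∘g≗id = record
  { to = f ; from = g
  ; from∘to = g∘f≗id , λ e → simpleX _ e (round-trip g f g∘f≗id e)
  ; to∘from = f∘g≗id , λ e → simpleY _ e (round-trip f g f∘g≗id e)
  }
  where
  round-trip : ∀ {X Y} (h : Hom Y X) (k : Hom X Y) → (∀ a → fV h (fV k a) ≡ a) →
               ∀ e → UEq (ends X (fE h (fE k e))) (ends X e)
  round-trip {X} h k h∘k≗id e rewrite sym (h∘k≗id (proj₁ (ends X e))) | sym (h∘k≗id (proj₂ (ends X e))) =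
    pres (h ∘H k) e

Surjective : Hom X Y → Set
Surjective {X} {Y} f = (∀ b → ∃ λ a → fV f a ≡ b) × (∀ e → ∃ λ d → fE f d ≡ e)

surjective-∘ : {g : Hom Y Z} {f : Hom X Y} → Surjective g → Surjective f → Surjective (g ∘H f)
surjective-∘ {g = g} (gV , gE) (fV-surj , fE-surj) =
  (λ c → let b , gb≡c = gV c ; a , fa≡b = fV-surj b in a , trans (cong (fV g) fa≡b) gb≡c) ,
  (λ e → let d , gd≡e = gE e ; d' , fd'≡d = fE-surj d in d' , trans (cong (fE g) fd'≡d) gd≡e)

from-surjective : (φ : Iso X Y) → Surjective (from φ)
from-surjective φ = (λ a → fV (to φ) a , proj₁ (from∘to φ) a) , (λ e → fE (to φ) e , proj₂ (from∘to φ) e)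

surjective⇒epi : {f : Hom X Y} → Surjective f → IsEpi f
surjective⇒epi {f = f} (fV-surj , fE-surj) Z h k (hf≗kf-V , hf≗kf-E) =
  (λ b → let a , fa≡b = fV-surj b in subst (λ b → fV h b ≡ fV k b) fa≡b (hf≗kf-V a)) ,
  (λ e → let d , fd≡e = fE-surj e in subst (λ e → fE h e ≡ fE k e) fd≡e (hf≗kf-E d))

∘H-congˡ : (h : Hom Y Z) {f g : Hom X Y} → f ≈H g → h ∘H f ≈H h ∘H g
∘H-congˡ h (f≗g-V , f≗g-E) = (λ a → cong (fV h) (f≗g-V a)) , (λ e → cong (fE h) (f≗g-E e))

equalizer-commutes : DecidableEquality (V Y) → DecidableEquality (E Y) → (f g : Hom X Y) →
                     f ∘H eqIncl f g ≈H g ∘H eqIncl f g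
-- The equations defining the equalizer are stored irrelevantly; decidable equality recovers them.
equalizer-commutes _≟V_ _≟E_ f g =
  (λ { (a , [ fa≡ga ]) → recompute (fV f a ≟V fV g a) fa≡ga }) ,
  (λ { (e , [ fe≡ge ]) → recompute (fE f e ≟E fE g e) (proj₁ fe≡ge) })

epi-covers : {δ : Hom X Y} → IsEpi δ → {P : V Y → Set} → Decidable P → (∀ a → P (fV δ a)) → ∀ b → P b
-- Every vertex map into the complete looped graph on Bool is a morphism, so the characteristic
-- map of P and the constant map are two morphisms agreeing on the image of δ.
epi-covers {X} {Y} {δ} δ-epi {P} P? P-image b =
  toWitness {a? = P? b} (Equivalence.from T-≡
    (proj₁ (δ-epi Bool² (classify (isYes ∘ P?)) (classify λ _ → true) (image-V , image-E)) b))
  where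
  Bool² : Graph
  Bool² = record { V = Bool ; E = Bool × Bool ; ends = λ p → p }
  classify : (V Y → Bool) → Hom Y Bool²
  classify χ = record { fV = χ ; fE = λ e → map² χ (ends Y e) ; pres = λ e → UEq-refl _ }
  image-V : ∀ a → isYes (P? (fV δ a)) ≡ true
  image-V a = Equivalence.to T-≡ (fromWitness {a? = P? (fV δ a)} (P-image a))
  image-E : ∀ d → map² (isYes ∘ P?) (ends Y (fE δ d)) ≡ map² (λ _ → true) (ends Y (fE δ d))
  image-E d = let t₁ , t₂ = UEq-both (λ b → isYes (P? b) ≡ true) (pres δ d)
                              (image-V (proj₁ (ends X d))) (image-V (proj₂ (ends X d)))
              in cong₂ _,_ t₁ t₂

≡⇒UEq : {p q : A × A} → p ≡ q → UEq p q
≡⇒UEq refl = UEq-refl _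

Iso-sym : Iso X Y → Iso Y X
Iso-sym φ = record { to = from φ ; from = to φ ; from∘to = to∘from φ ; to∘from = from∘to φ }

module _ {X Y : Graph} {v : V X} {w : V Y} (_≟_ : DecidableEquality (V X)) (f : Hom (X ─ v) (Y ─ w)) where

  extend : V X → V Y
  extend a with a ≟ v
  ... | yes _   = w
  ... | no a≢v  = value (fV f (a , [ a≢v ]))

  extend-base : extend v ≡ w
  extend-base with v ≟ v
  ... | yes _   = refl
  ... | no v≢v  = contradiction refl v≢v

  extend-punctured : ∀ (r : V (X ─ v)) → extend (value r) ≡ value (fV f r)
  extend-punctured (a , [ a≢v ]) with a ≟ v
  ... | yes a≡v = ⊥-elim-irr (a≢v a≡v)
  ... | no _    = refl

  extend-adjacent : ∀ {a b} → a ≢ v → b ≢ v → Adjacent X a b → Adjacent Y (extend a) (extend b)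
  extend-adjacent a≢v b≢v (e , ends≡) =
    value (fE f punctured-e) ,
    UEq-trans (UEq-map value (pres f punctured-e))
      (UEq-trans (≡⇒UEq (cong₂ _,_ (sym (extend-punctured (proj₁ (ends (X ─ v) punctured-e))))
                               (sym (extend-punctured (proj₂ (ends (X ─ v) punctured-e))))))
        (UEq-map extend ends≡))
    where
    avoids = UEq-both (_≢ v) ends≡ a≢v b≢v
    punctured-e : E (X ─ v)
    punctured-e = e , [ avoids ]

extend-inverse : (_≟X_ : DecidableEquality (V X)) (_≟Y_ : DecidableEquality (V Y)) → ∀ {v w} (φ : Iso (X ─ v) (Y ─ w)) →
                 ∀ a → extend _≟Y_ (from φ) (extend _≟X_ (to φ) a) ≡ a
extend-inverse {X} {Y} _≟X_ _≟Y_ {v} φ a with a ≟X v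
... | yes refl = extend-base _≟Y_ (from φ)
... | no a≢v   = trans (extend-punctured _≟Y_ (from φ) (fV (to φ) (a , [ a≢v ])))
                       (cong value (proj₁ (from∘to φ) (a , [ a≢v ])))

extend↔ : DecidableEquality (V X) → DecidableEquality (V Y) → ∀ {v w} → Iso (X ─ v) (Y ─ w) → V X ↔ V Y
extend↔ _≟X_ _≟Y_ φ = mk↔ₛ′ (extend _≟X_ (to φ)) (extend _≟Y_ (from φ))
  (extend-inverse _≟Y_ _≟X_ (Iso-sym φ)) (extend-inverse _≟X_ _≟Y_ φ)

module Factorisation {C H G : Graph} (Γ : Hom C H) (Γ-surjective : Surjective Γ) (δ : Hom C G)
  (δ-respects : ∀ {c c'} → fV Γ c ≡ fV Γ c' → fV δ c ≡ fV δ c') where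

  factor : Hom H G
  factor = record
    { fV = λ b → fV δ (proj₁ (proj₁ Γ-surjective b))
    ; fE = λ e → fE δ (proj₁ (proj₂ Γ-surjective e))
    ; pres = pres-factor
    }
    where
    pres-factor : ∀ e → UEq (ends G (fE δ (proj₁ (proj₂ Γ-surjective e))))
                            (map² (λ b → fV δ (proj₁ (proj₁ Γ-surjective b))) (ends H e))
    pres-factor e with proj₂ Γ-surjective e
    ... | c , refl = UEq-trans (pres δ c) (UEq-trans
      (≡⇒UEq (cong₂ _,_ (δ-respects (sym (proj₂ (proj₁ Γ-surjective _))))
                        (δ-respects (sym (proj₂ (proj₁ Γ-surjective _))))))
      (UEq-map (λ b → fV δ (proj₁ (proj₁ Γ-surjective b))) (UEq-sym (pres Γ c))))

  factor-∘ : ∀ c → fV factor (fV Γ c) ≡ fV δ c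
  factor-∘ c = δ-respects (proj₂ (proj₁ Γ-surjective (fV Γ c)))

module _ (G H : Graph) {I : Set} (σ : I → V G) (τ : I → V H) (γ : ∀ i → Iso (G ─ σ i) (H ─ τ i)) where

  Γ-surjective : (∀ a b → ∃ λ i → τ i ≢ a × τ i ≢ b) → Surjective (Γmap G H σ τ γ)
  Γ-surjective avoid = vertex , edge
    where
    vertex : ∀ b → ∃ λ c → fV (Γmap G H σ τ γ) c ≡ b
    vertex b = let i , τi≢b , _ = avoid b b in
      (i , fV (from (γ i)) (b , [ ≢-sym τi≢b ])) , cong value (proj₁ (to∘from (γ i)) _)
    edge : ∀ e → ∃ λ d → fE (Γmap G H σ τ γ) d ≡ e
    edge e = let i , τi≢a , τi≢b = avoid (proj₁ (ends H e)) (proj₂ (ends H e)) in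
      (i , fE (from (γ i)) (e , [ ≢-sym τi≢a , ≢-sym τi≢b ])) , cong value (proj₂ (to∘from (γ i)) _)

adjacent-coordinates : ∀ {X : Graph} {n} (χ : Fin n ↔ V X) {a b} →
                       Adjacent X a b → (Adjacent X on Inverse.to χ) (Inverse.from χ a) (Inverse.from χ b)
adjacent-coordinates {X} χ = subst₂ (Adjacent X) (sym (strictlyInverseˡ χ _)) (sym (strictlyInverseˡ χ _))

↔-preserves-≢ : ∀ {A B : Set} (χ : A ↔ B) {x y} → x ≢ y → Inverse.to χ x ≢ Inverse.to χ y
↔-preserves-≢ χ x≢y χx≡χy = x≢y (Injection.injective (↔⇒↣ χ) χx≡χy)

module Hypomorphic (G H : Graph) {I : Set} (σ : I ↔ V G) (τ : I ↔ V H)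
  (γ : (i : I) → Iso (G ─ Inverse.to σ i) (H ─ Inverse.to τ i))
  (_≟G_ : DecidableEquality (V G)) (_≟H_ : DecidableEquality (V H))
  (looplessG : Loopless G) (looplessH : Loopless H) (simpleG : NoMultiEdges G) (simpleH : NoMultiEdges H)
  {n : ℕ} (3≤n : 3 ≤ n) (index : Fin n ↔ I) where

  χG : Fin n ↔ V G
  χG = ↔-trans index σ
  χH : Fin n ↔ V H
  χH = ↔-trans index τ

  deck : Fin n → Permutation′ n
  deck j = ↔-trans χG (↔-trans (extend↔ _≟G_ _≟H_ (γ (Inverse.to index j))) (↔-sym χH))

  deck-fixes : ∀ j → deck j ⟨$⟩ʳ j ≡ j
  deck-fixes j = trans (cong (Inverse.from χH) (extend-base _≟G_ (to (γ (Inverse.to index j))))) (strictlyInverseʳ χH j)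

  deck-adjacent : ∀ j {x y} → x ≢ j → y ≢ j → (Adjacent G on Inverse.to χG) x y →
                  (Adjacent H on Inverse.to χH) (deck j ⟨$⟩ʳ x) (deck j ⟨$⟩ʳ y)
  deck-adjacent j {x} {y} x≢j y≢j adj = adjacent-coordinates χH
    (extend-adjacent _≟G_ (to (γ (Inverse.to index j))) (↔-preserves-≢ χG {x} {j} x≢j) (↔-preserves-≢ χG {y} {j} y≢j) adj)

  deck⁻¹-adjacent : ∀ j {x y} → x ≢ j → y ≢ j → (Adjacent H on Inverse.to χH) x y →
                    (Adjacent G on Inverse.to χG) (deck j ⟨$⟩ˡ x) (deck j ⟨$⟩ˡ y)
  deck⁻¹-adjacent j {x} {y} x≢j y≢j adj = adjacent-coordinates χG
    (extend-adjacent _≟H_ (from (γ (Inverse.to index j))) (↔-preserves-≢ χH {x} {j} x≢j) (↔-preserves-≢ χH {y} {j} y≢j) adj)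

  surjective-hom⇒iso : (u : Hom H G) → (∀ a → ∃ λ b → fV u b ≡ a) → Iso G H
  surjective-hom⇒iso u u-surjective = simple-iso simpleG simpleH (Hom-from-adjacency s s-adjacent) u u∘s s∘u
    where
    uᶠ : Fin n → Fin n
    uᶠ j = Inverse.from χG (fV u (Inverse.to χH j))

    uᶠ-surjective : ∀ y → ∃ λ j → uᶠ j ≡ y
    uᶠ-surjective y with u-surjective (Inverse.to χG y)
    ... | b , ub≡χy = Inverse.from χH b , (begin
      Inverse.from χG (fV u (Inverse.to χH (Inverse.from χH b))) ≡⟨ cong (Inverse.from χG ∘ fV u) (strictlyInverseˡ χH b) ⟩
      Inverse.from χG (fV u b)                                   ≡⟨ cong (Inverse.from χG) ub≡χy ⟩
      Inverse.from χG (Inverse.to χG y)                          ≡⟨ strictlyInverseʳ χG y ⟩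
      y                                                          ∎)
      where open ≡-Reasoning

    π : Permutation′ n
    π = surjection⇒permutation uᶠ uᶠ-surjective

    open Transfer 3≤n deck deck-fixes π (Adjacent G on Inverse.to χG) (Adjacent H on Inverse.to χH)
      (loopless⇒irreflexive looplessG ∘ cong (Inverse.to χG)) (loopless⇒irreflexive looplessH ∘ cong (Inverse.to χH))
      deck-adjacent deck⁻¹-adjacent
      (λ adj → adjacent-coordinates χG (Hom-adjacent u adj))
      using (transfer)

    s : V G → V H
    s a = Inverse.to χH (π ⟨$⟩ˡ Inverse.from χG a)

    s-adjacent : ∀ {a b} → Adjacent G a b → Adjacent H (s a) (s b)
    s-adjacent adj = transfer (adjacent-coordinates χG adj)

    u∘s : ∀ a → fV u (s a) ≡ a
    u∘s a = begin
      fV u (Inverse.to χH (π ⟨$⟩ˡ Inverse.from χG a))  ≡⟨ strictlyInverseˡ χG _ ⟨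
      Inverse.to χG (π ⟨$⟩ʳ (π ⟨$⟩ˡ Inverse.from χG a)) ≡⟨ cong (Inverse.to χG) (inverseʳ π) ⟩
      Inverse.to χG (Inverse.from χG a)                ≡⟨ strictlyInverseˡ χG a ⟩
      a                                                ∎
      where open ≡-Reasoning

    s∘u : ∀ b → s (fV u b) ≡ b
    s∘u b = begin
      s (fV u b)                                         ≡⟨ cong (s ∘ fV u) (strictlyInverseˡ χH b) ⟨
      Inverse.to χH (π ⟨$⟩ˡ (π ⟨$⟩ʳ Inverse.from χH b))  ≡⟨ cong (Inverse.to χH) (inverseˡ π) ⟩
      Inverse.to χH (Inverse.from χH b)                  ≡⟨ strictlyInverseˡ χH b ⟩
      b                                                  ∎
      where open ≡-Reasoning

three-vertices⇒avoid : ∀ {I : Set} {X : Graph} (τ : I ↔ V X) → AtLeast3Vertices X →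
                       ∀ a b → ∃ λ i → Inverse.to τ i ≢ a × Inverse.to τ i ≢ b
three-vertices⇒avoid τ (n , ι , 3≤n) a b =
  let c , c≢a , c≢b = avoid-two 3≤n (Inverse.to ι a) (Inverse.to ι b) in
  Inverse.from τ (Inverse.from ι c) ,
  subst (λ x → x ≢ a × x ≢ b) (sym (strictlyInverseˡ τ _)) (avoids c≢a , avoids c≢b)
  where
  avoids : ∀ {c x} → c ≢ Inverse.to ι x → Inverse.from ι c ≢ x
  avoids c≢ιx refl = c≢ιx (sym (strictlyInverseˡ ι _))

image-decidable : ∀ {A B : Set} {n} → A ↔ Fin n → DecidableEquality B → (f : A → B) →
                  Decidable (λ b → ∃ λ a → f a ≡ b)
image-decidable ι _≟_ f b = map′ (λ (j , eq) → Inverse.from ι j , eq)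
  (λ (a , eq) → Inverse.to ι a , trans (cong f (strictlyInverseʳ ι a)) eq)
  (any? λ j → f (Inverse.from ι j) ≟ b)

mainTheorem5 :  (G H : Graph) →
  IsFiniteSimple G → IsFiniteSimple H →
  AtLeast3Vertices G → AtLeast3Vertices H →
  (I : Set) (σ : I ↔ V G) (τ : I ↔ V H) →
  (γ : (i : I) → Iso (G ─ Inverse.to σ i) (H ─ Inverse.to τ i)) →
  let Gs = λ i → G ─ Inverse.to σ i
      C = ∐ Gs
      Γ = Γmap G H (Inverse.to σ) (Inverse.to τ) γ
      p₀ = π₀ C C
      p₁ = π₁ C C
      k = eqIncl (Γ ∘H p₀) (Γ ∘H p₁)
  in Iso G H ⇔ Σ (Hom C G) (λ δ → IsEpi δ × (δ ∘H p₀ ∘H k ≈H δ ∘H p₁ ∘H k))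
mainTheorem5 G H (_ , looplessG , simpleG) (_ , looplessH , simpleH) (_ , ιG , 3≤n) three-vertices-H@(_ , ιH , _) I σ τ γ =
  mk⇔ forward backward
  where
  C : Graph
  C = ∐ (λ i → G ─ Inverse.to σ i)
  Γ : Hom C H
  Γ = Γmap G H (Inverse.to σ) (Inverse.to τ) γ
  p₀ p₁ : Hom (C ⊗ C) C
  p₀ = π₀ C C
  p₁ = π₁ C C
  k : Hom (Equalizer (Γ ∘H p₀) (Γ ∘H p₁)) (C ⊗ C)
  k = eqIncl (Γ ∘H p₀) (Γ ∘H p₁)
  _≟G_ : DecidableEquality (V G)
  _≟G_ = via-injection (↔⇒↣ ιG) _≟_
  _≟H_ : DecidableEquality (V H)
  _≟H_ = via-injection (↔⇒↣ ιH) _≟_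
  Γ-surj : Surjective Γ
  Γ-surj = Γ-surjective G H (Inverse.to σ) (Inverse.to τ) γ (three-vertices⇒avoid {X = H} τ three-vertices-H)
  open Hypomorphic G H σ τ γ _≟G_ _≟H_ looplessG looplessH simpleG simpleH 3≤n (↔-trans (↔-sym ιG) (↔-sym σ))

  forward : Iso G H → Σ (Hom C G) (λ δ → IsEpi δ × (δ ∘H p₀ ∘H k ≈H δ ∘H p₁ ∘H k))
  forward φ = from φ ∘H Γ ,
    surjective⇒epi {f = from φ ∘H Γ} (surjective-∘ {g = from φ} {f = Γ} (from-surjective φ) Γ-surj) ,
    ∘H-congˡ (from φ) {f = (Γ ∘H p₀) ∘H k} {g = (Γ ∘H p₁) ∘H k}
      (equalizer-commutes _≟H_ (edge-decEq {H} _≟H_ simpleH) (Γ ∘H p₀) (Γ ∘H p₁))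

  backward : Σ (Hom C G) (λ δ → IsEpi δ × (δ ∘H p₀ ∘H k ≈H δ ∘H p₁ ∘H k)) → Iso G H
  backward (δ , δ-epi , δ-coequalises) =
    surjective-hom⇒iso factor
      (epi-covers {δ = δ} δ-epi (image-decidable ιH _≟G_ (fV factor)) (λ c → fV Γ c , factor-∘ c))
    where
    open Factorisation Γ Γ-surj δ (λ {c} {c'} Γc≡Γc' → proj₁ δ-coequalises ((c , c') , [ Γc≡Γc' ]))
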